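{- Let $G$ be a complete wheel with $n\geq8$ vertices, with cycle $C=\{c_1,\dots,c_{n-1}\}$ and central vertex $h$. A set $L\subseteq C$ is an AP-landmark set for parameter $k=2$ if and only if it satisfies the following condition: for every $i$, if $c_i,c_{i+1}\notin L$ then $c_{i-3},c_{i-2},c_{i-1},c_{i+2},c_{i+3},c_{i+4}\in L$. Moreover, $md_2^{AP}(G)=\lfloor n/2\rfloor$.
   Context: The complete wheel on $n$ vertices has vertex set $V=C\cup\{h\}$ with $C=\{c_1,\dots,c_{n-1}\}$, edges $\{c_i,h\}$ and $\{c_i,c_{i+1}\}$ for $1\le i\le n-1$; cycle indices are taken modulo $n-1$ (i.e., $c_i=c_b$ with $1\le b\le n-1$, $b\equiv i \pmod{n-1}$). $d(x,y)$ denotes graph distance; $\tau$ separates distinct $u,v$ if $d(u,\tau)\neq d(v,\tau)$. $L\subseteq V$ is an AP-landmark set for parameter $k$ if every pair of distinct $u,v\in V$ is separated by at least $k$ distinct vertices of $L$; $md_k^{AP}(G)$ is the minimum cardinality of such a set. -}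

module Defs where

open import Data.Nat using (ℕ; zero; suc; _+_; _≤_; _%_)
open import Data.Nat.DivMod using (m%n<n)
open import Data.Fin using (Fin; zero; suc; toℕ; fromℕ<)
open import Data.Fin.Subset using (Subset; _∈_)
open import Data.Unit using (⊤)
open import Data.Empty using (⊥)
open import Data.Sum using (_⊎_)
open import Data.Product using (Σ; _×_)
open import Relation.Binary.PropositionalEquality using (_≡_; _≢_)
open import Function.Definitions using (Injective)

-- Cycle positions: Fin m, position j (0-based) stands for c_{j+1}.
-- shift i k = position of c_{i+k}, indices modulo m (the cycle length n-1).
shift : ∀ {m} → Fin m → ℕ → Fin m
shift {suc m} i k = fromℕ< (m%n<n (toℕ i + k) (suc m))

CycAdj : ∀ {m} → Fin m → Fin m → Set
CycAdj i j = j ≡ shift i 1 ⊎ i ≡ shift j 1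

-- The complete wheel on n = suc m vertices: vertex set Fin (suc m),
-- vertex zero is the hub h, vertex suc j is the cycle vertex c_{j+1}.
hub : ∀ {m} → Fin (suc m)
hub = zero

cyc : ∀ {m} → Fin m → Fin (suc m)
cyc = suc

Adj : ∀ {m} → Fin (suc m) → Fin (suc m) → Set
Adj zero    zero    = ⊥
Adj zero    (suc j) = ⊤
Adj (suc i) zero    = ⊤
Adj (suc i) (suc j) = CycAdj i j

data Walk {m : ℕ} : Fin (suc m) → Fin (suc m) → ℕ → Set where
  here : ∀ {x} → Walk x x 0
  step : ∀ {x y z k} → Adj x y → Walk y z k → Walk x z (suc k)

Dist : ∀ {m} → Fin (suc m) → Fin (suc m) → ℕ → Set
Dist x y d = Walk x y d × (∀ k → Walk x y k → d ≤ k)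

Separates : ∀ {m} → Fin (suc m) → Fin (suc m) → Fin (suc m) → Set
Separates u v τ = ∀ a b → Dist u τ a → Dist v τ b → a ≢ b

IsAPLandmark : ∀ {m} → ℕ → Subset (suc m) → Set
IsAPLandmark {m} k L =
  ∀ (u v : Fin (suc m)) → u ≢ v →
    Σ (Fin k → Fin (suc m)) λ f →
      Injective _≡_ _≡_ f × (∀ j → f j ∈ L × Separates u v (f j))

module Submission where

-- Distances in a wheel are 0, 1 or 2: the hub is adjacent to every cycle vertex, and two
-- cycle vertices are at distance 1 when consecutive and at distance 2 (via h) otherwise.
-- Hence separation is local on the cycle, and the proof works in "frames": pos b r is
-- c_{b+r}, and every pair of vertices is moved into a frame where its separators are
-- explicit consecutive positions.
--
-- * Forward: c_i, c_{i+1} are separated only by c_{i-1}, …, c_{i+2}, and c_{i+1}, c_{i+3}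
--   only by c_i, c_{i+1}, c_{i+3}, c_{i+4}; if c_i, c_{i+1} ∉ L, the two landmark
--   separators required for the pairs (c_i, c_{i+1}), (c_{i+1}, c_{i+3}), (c_{i-2}, c_i)
--   are forced, which is the gap condition.
-- * Backward: by the gap condition every three consecutive positions contain a landmark
--   and every four contain two; each pair of vertices (hub and c_j, or c_a and c_{a+r} by
--   the size of r) has such a block of separators, or a landmark near each of its ends.
-- * Minimum: a gap z, z+1 forces the present pair z+2, z+3, and exchanging these pairs
--   (the half-density lemma) shows that L contains at least half of the cycle; the even
--   positions leave no gap and attain ⌊n/2⌋.

open import Defs
open import Data.Nat using (ℕ; zero; suc; _+_; _*_; _∸_; _≤_; _<_; _/_; z≤n; s≤s; s≤s⁻¹; _≤?_)
open import Data.Nat.Properties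
open import Data.Nat.DivMod
open import Data.Bool using (Bool; true; false; not; _∧_)
open import Data.Fin using (Fin; toℕ) renaming (zero to fzero; suc to fsuc)
open import Data.Fin.Properties using (toℕ-injective; toℕ-fromℕ<; toℕ<n)
  renaming (suc-injective to fsuc-injective)
open import Data.Fin.Subset using (Subset; _∈_; _∉_; ∣_∣)
open import Data.Fin.Subset.Properties using (_∈?_; ∣p∣≤∣x∷p∣)
open import Data.Vec using (Vec; []; _∷_; lookup)
open import Data.Vec.Base using (there)
open import Data.Vec.Properties using ([]=⇒lookup; lookup⇒[]=)
open import Data.Product using (Σ; _×_; _,_; proj₁; proj₂)
open import Data.Sum using (_⊎_; inj₁; inj₂; swap)
open import Data.Empty using (⊥-elim)
open import Data.Unit using (tt)
open import Function using (_∘_)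
open import Function.Bundles using (_⇔_; mk⇔)
open import Function.Definitions using (Injective)
open import Relation.Nullary using (¬_; Dec; yes; no)
open import Relation.Nullary.Decidable using (True; toWitness)
open import Relation.Binary.PropositionalEquality
  using (_≡_; _≢_; refl; sym; trans; cong; cong₂; subst; subst₂; module ≡-Reasoning)
open import Algebra.Properties.CommutativeSemigroup +-commutativeSemigroup using (interchange)

sumTo : ℕ → (ℕ → ℕ) → ℕ
sumTo zero    f = 0
sumTo (suc n) f = f 0 + sumTo n (f ∘ suc)

sum-mono : ∀ n {f g : ℕ → ℕ} → (∀ z → f z ≤ g z) → sumTo n f ≤ sumTo n g
sum-mono zero    f≤g = z≤n
sum-mono (suc n) f≤g = +-mono-≤ (f≤g 0) (sum-mono n (f≤g ∘ suc))

sum-cong : ∀ n {f g : ℕ → ℕ} → (∀ z → z < n → f z ≡ g z) → sumTo n f ≡ sumTo n g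
sum-cong zero    f≗g = refl
sum-cong (suc n) f≗g =
  cong₂ _+_ (f≗g 0 (s≤s z≤n)) (sum-cong n (λ z z<n → f≗g (suc z) (s≤s z<n)))

sum-+ : ∀ n (f g : ℕ → ℕ) → sumTo n (λ z → f z + g z) ≡ sumTo n f + sumTo n g
sum-+ zero    f g = refl
sum-+ (suc n) f g =
  trans (cong (f 0 + g 0 +_) (sum-+ n (f ∘ suc) (g ∘ suc)))
        (interchange (f 0) (g 0) (sumTo n (f ∘ suc)) (sumTo n (g ∘ suc)))

sum-ones : ∀ n → sumTo n (λ _ → 1) ≡ n
sum-ones zero    = refl
sum-ones (suc n) = cong suc (sum-ones n)

sum-rotate-end : ∀ n (f : ℕ → ℕ) → sumTo n (f ∘ suc) + f 0 ≡ sumTo n f + f n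
sum-rotate-end zero    f = refl
sum-rotate-end (suc n) f = begin
    f 1 + sumTo n (f ∘ suc ∘ suc) + f 0     ≡⟨ +-comm (f 1 + _) (f 0) ⟩
    f 0 + (f 1 + sumTo n (f ∘ suc ∘ suc))   ≡⟨ cong (f 0 +_) (+-comm (f 1) _) ⟩
    f 0 + (sumTo n (f ∘ suc ∘ suc) + f 1)   ≡⟨ cong (f 0 +_) (sum-rotate-end n (f ∘ suc)) ⟩
    f 0 + (sumTo n (f ∘ suc) + f (suc n))   ≡⟨ sym (+-assoc (f 0) _ _) ⟩
    f 0 + sumTo n (f ∘ suc) + f (suc n)     ∎
  where open ≡-Reasoning

sum-rotate : ∀ n (f : ℕ → ℕ) → f n ≡ f 0 → sumTo n (f ∘ suc) ≡ sumTo n f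
sum-rotate n f fn≡f0 =
  +-cancelʳ-≡ (f 0) _ _ (trans (sum-rotate-end n f) (cong (sumTo n f +_) fn≡f0))

χ : Bool → ℕ
χ true  = 1
χ false = 0

χ-not : ∀ x → χ (not x) + χ x ≡ 1
χ-not true  = refl
χ-not false = refl

ones : ℕ → (ℕ → Bool) → ℕ
ones n b = sumTo n (χ ∘ b)

-- The local exchange behind the count: an absent pair (x, y) is paid for by the
-- present pair c that it forces two steps later.
pair-exchange : ∀ x y c → (x ≡ false → y ≡ false → c ≡ true) →
                χ (not y) + χ (x ∧ y) ≤ χ x + χ c
pair-exchange true  true  c _      = s≤s z≤n
pair-exchange true  false c _      = s≤s z≤n
pair-exchange false true  c _      = z≤n
pair-exchange false false c forced rewrite forced refl refl = ≤-refl

-- Summing pair-exchange over a period, the present pairs cancel by rotation.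
half-density : ∀ n (b : ℕ → Bool) → (∀ z → b (z + n) ≡ b z) →
               (∀ z → b z ≡ false → b (suc z) ≡ false → b (2 + z) ∧ b (3 + z) ≡ true) →
               n ≤ ones n b + ones n b
half-density n b periodic forced = begin
    n                                         ≡⟨ sym (sum-ones n) ⟩
    sumTo n (λ _ → 1)                         ≡⟨ sum-cong n (λ z _ → sym (χ-not (b z))) ⟩
    sumTo n (λ z → χ (not (b z)) + χ (b z))   ≡⟨ sum-+ n (χ ∘ not ∘ b) (χ ∘ b) ⟩
    zeros + ones n b                          ≤⟨ +-monoˡ-≤ (ones n b) zeros≤ones ⟩
    ones n b + ones n b                       ∎
  where
    open ≤-Reasoning
    zeros : ℕ
    zeros = sumTo n (χ ∘ not ∘ b)

    pair : ℕ → ℕ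
    pair z = χ (b z ∧ b (suc z))

    pairs : ℕ
    pairs = sumTo n pair

    pair-periodic : ∀ z → pair (z + n) ≡ pair z
    pair-periodic z = cong₂ (λ x y → χ (x ∧ y)) (periodic z) (periodic (suc z))

    pairs-rotate₂ : sumTo n (pair ∘ suc ∘ suc) ≡ pairs
    pairs-rotate₂ = trans (sum-rotate n (pair ∘ suc) (pair-periodic 1))
                          (sum-rotate n pair (pair-periodic 0))

    zeros≤ones : zeros ≤ ones n b
    zeros≤ones = +-cancelʳ-≤ pairs zeros (ones n b) (begin
      zeros + pairs
        ≡⟨ cong (_+ pairs) (sym (sum-rotate n (χ ∘ not ∘ b) (cong (χ ∘ not) (periodic 0)))) ⟩
      sumTo n (χ ∘ not ∘ b ∘ suc) + pairs
        ≡⟨ sym (sum-+ n (χ ∘ not ∘ b ∘ suc) pair) ⟩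
      sumTo n (λ z → χ (not (b (suc z))) + pair z)
        ≤⟨ sum-mono n (λ z → pair-exchange (b z) (b (suc z)) _ (forced z)) ⟩
      sumTo n (λ z → χ (b z) + pair (2 + z))
        ≡⟨ sum-+ n (χ ∘ b) (pair ∘ suc ∘ suc) ⟩
      ones n b + sumTo n (pair ∘ suc ∘ suc)
        ≡⟨ cong (ones n b +_) pairs-rotate₂ ⟩
      ones n b + pairs ∎)

half-bound : ∀ {n o} → n ≤ o + o → suc n / 2 ≤ o
half-bound {n} {o} n≤o+o =
  s≤s⁻¹ (m<n*o⇒m/o<n (s≤s (s≤s (subst (n ≤_) o+o≡o*2 n≤o+o))))
  where
    o+o≡o*2 : o + o ≡ o * 2
    o+o≡o*2 = trans (cong (o +_) (sym (+-identityʳ o))) (*-comm 2 o)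

bitAt : ∀ {n} → Vec Bool n → ℕ → Bool
bitAt []      _       = false
bitAt (x ∷ v) zero    = x
bitAt (x ∷ v) (suc z) = bitAt v z

bitAt-toℕ : ∀ {n} (v : Vec Bool n) (j : Fin n) → bitAt v (toℕ j) ≡ lookup v j
bitAt-toℕ (x ∷ v) fzero    = refl
bitAt-toℕ (x ∷ v) (fsuc j) = bitAt-toℕ v j

size-as-sum : ∀ {n} (v : Subset n) → ∣ v ∣ ≡ ones n (bitAt v)
size-as-sum []          = refl
size-as-sum (true ∷ v)  = cong suc (size-as-sum v)
size-as-sum (false ∷ v) = size-as-sum v

even : ℕ → Bool
even zero          = true
even (suc zero)    = false
even (suc (suc z)) = even z

even-or-next : ∀ z → even z ≡ true ⊎ even (suc z) ≡ true
even-or-next zero          = inj₁ refl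
even-or-next (suc zero)    = inj₂ refl
even-or-next (suc (suc z)) = even-or-next z

evens : ∀ n → Subset n
evens zero          = []
evens (suc zero)    = true ∷ []
evens (suc (suc n)) = true ∷ false ∷ evens n

lookup-evens : ∀ n (j : Fin n) → lookup (evens n) j ≡ even (toℕ j)
lookup-evens (suc zero)    fzero           = refl
lookup-evens (suc (suc n)) fzero           = refl
lookup-evens (suc (suc n)) (fsuc fzero)    = refl
lookup-evens (suc (suc n)) (fsuc (fsuc j)) = lookup-evens n j

size-evens : ∀ n → ∣ evens n ∣ ≡ suc n / 2
size-evens zero          = refl
size-evens (suc zero)    = refl
size-evens (suc (suc n)) =
  trans (cong suc (size-evens n)) (sym (m/n≡1+[m∸n]/n {suc (suc (suc n))} {2} (s≤s (s≤s z≤n))))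

last-two : ∀ {a e} → a ≤ e → e ≤ suc a → e ≡ a ⊎ e ≡ suc a
last-two a≤e e≤1+a with m≤n⇒m<n∨m≡n a≤e
... | inj₁ a<e = inj₂ (≤-antisym e≤1+a a<e)
... | inj₂ a≡e = inj₁ (sym a≡e)

module _ {n : ℕ} where
  private
    m : ℕ
    m = suc n

  %-absorbˡ : ∀ x y → (x % m + y) % m ≡ (x + y) % m
  %-absorbˡ x y = begin
      (x % m + y) % m            ≡⟨ %-distribˡ-+ (x % m) y m ⟩
      (x % m % m + y % m) % m    ≡⟨ %-congˡ (cong (_+ y % m) (m%n%n≡m%n x m)) ⟩
      (x % m + y % m) % m        ≡⟨ sym (%-distribˡ-+ x y m) ⟩
      (x + y) % m                ∎
    where open ≡-Reasoning

  shift-toℕ : ∀ (b : Fin m) r → toℕ (shift b r) ≡ (toℕ b + r) % m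
  shift-toℕ b r = toℕ-fromℕ< _

  shift-shift : ∀ (b : Fin m) r s → shift (shift b r) s ≡ shift b (r + s)
  shift-shift b r s = toℕ-injective (begin
      toℕ (shift (shift b r) s)   ≡⟨ shift-toℕ (shift b r) s ⟩
      (toℕ (shift b r) + s) % m   ≡⟨ %-congˡ (cong (_+ s) (shift-toℕ b r)) ⟩
      ((toℕ b + r) % m + s) % m   ≡⟨ %-absorbˡ (toℕ b + r) s ⟩
      (toℕ b + r + s) % m         ≡⟨ %-congˡ (+-assoc (toℕ b) r s) ⟩
      (toℕ b + (r + s)) % m       ≡⟨ sym (shift-toℕ b (r + s)) ⟩
      toℕ (shift b (r + s))       ∎)
    where open ≡-Reasoning

  shift-zero : ∀ (b : Fin m) → shift b 0 ≡ b
  shift-zero b = toℕ-injective (begin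
      toℕ (shift b 0)   ≡⟨ shift-toℕ b 0 ⟩
      (toℕ b + 0) % m   ≡⟨ %-congˡ (+-identityʳ (toℕ b)) ⟩
      toℕ b % m         ≡⟨ m<n⇒m%n≡m (toℕ<n b) ⟩
      toℕ b             ∎)
    where open ≡-Reasoning

  shift-period : ∀ (b : Fin m) r → shift b (r + m) ≡ shift b r
  shift-period b r = toℕ-injective (begin
      toℕ (shift b (r + m))   ≡⟨ shift-toℕ b (r + m) ⟩
      (toℕ b + (r + m)) % m   ≡⟨ %-congˡ (sym (+-assoc (toℕ b) r m)) ⟩
      (toℕ b + r + m) % m     ≡⟨ [m+n]%n≡m%n (toℕ b + r) m ⟩
      (toℕ b + r) % m         ≡⟨ sym (shift-toℕ b r) ⟩
      toℕ (shift b r)         ∎)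
    where open ≡-Reasoning

  shift-wrap : ∀ (b : Fin m) r s t → r + s ≡ t + m → shift (shift b r) s ≡ shift b t
  shift-wrap b r s t r+s≡t+m =
    trans (shift-shift b r s) (trans (cong (shift b) r+s≡t+m) (shift-period b t))

  toℕ-shift-one : ∀ (b : Fin m) → toℕ (shift b 1) ≡ suc (toℕ b) ⊎ toℕ (shift b 1) ≡ 0
  toℕ-shift-one b with m≤n⇒m<n∨m≡n (toℕ<n b)
  ... | inj₁ 1+b<m = inj₁ (trans (shift-toℕ b 1)
                          (trans (%-congˡ (+-comm (toℕ b) 1)) (m<n⇒m%n≡m 1+b<m)))
  ... | inj₂ 1+b≡m = inj₂ (trans (shift-toℕ b 1)
                          (trans (%-congˡ (trans (+-comm (toℕ b) 1) 1+b≡m)) (n%n≡0 m)))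

  full-turn : ∀ (b : Fin m) x → toℕ b + (x + (m ∸ toℕ b)) ≡ x + m
  full-turn b x = begin
      toℕ b + (x + (m ∸ toℕ b))   ≡⟨ cong (toℕ b +_) (+-comm x _) ⟩
      toℕ b + ((m ∸ toℕ b) + x)   ≡⟨ sym (+-assoc (toℕ b) _ x) ⟩
      toℕ b + (m ∸ toℕ b) + x     ≡⟨ cong (_+ x) (m+[n∸m]≡n (<⇒≤ (toℕ<n b))) ⟩
      m + x                       ≡⟨ +-comm m x ⟩
      x + m                       ∎
    where open ≡-Reasoning

  unshift : ∀ (b : Fin m) {r} → r < m → toℕ (shift (shift b r) (m ∸ toℕ b)) ≡ r
  unshift b {r} r<m = begin
      toℕ (shift (shift b r) (m ∸ toℕ b))  ≡⟨ cong toℕ (shift-shift b r _) ⟩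
      toℕ (shift b (r + (m ∸ toℕ b)))      ≡⟨ shift-toℕ b _ ⟩
      (toℕ b + (r + (m ∸ toℕ b))) % m      ≡⟨ %-congˡ (full-turn b r) ⟩
      (r + m) % m                          ≡⟨ [m+n]%n≡m%n r m ⟩
      r % m                                ≡⟨ m<n⇒m%n≡m r<m ⟩
      r                                    ∎
    where open ≡-Reasoning

  shift-injective : ∀ (b : Fin m) {r s} → r < m → s < m → shift b r ≡ shift b s → r ≡ s
  shift-injective b r<m s<m br≡bs =
    trans (sym (unshift b r<m)) (trans (cong back br≡bs) (unshift b s<m))
    where
      back : Fin m → ℕ
      back x = toℕ (shift x (m ∸ toℕ b))

  shift-onto : ∀ (b j : Fin m) → Σ ℕ λ r → r < m × shift b r ≡ j
  shift-onto b j = x % m , m%n<n x m , toℕ-injective (begin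
      toℕ (shift b (x % m))   ≡⟨ shift-toℕ b (x % m) ⟩
      (toℕ b + x % m) % m     ≡⟨ %-congˡ (+-comm (toℕ b) (x % m)) ⟩
      (x % m + toℕ b) % m     ≡⟨ %-absorbˡ x (toℕ b) ⟩
      (x + toℕ b) % m         ≡⟨ %-congˡ (+-comm x (toℕ b)) ⟩
      (toℕ b + x) % m         ≡⟨ %-congˡ (full-turn b (toℕ j)) ⟩
      (toℕ j + m) % m         ≡⟨ [m+n]%n≡m%n (toℕ j) m ⟩
      toℕ j % m               ≡⟨ m<n⇒m%n≡m (toℕ<n j) ⟩
      toℕ j                   ∎)
    where
      open ≡-Reasoning
      x : ℕ
      x = toℕ j + (m ∸ toℕ b)

module _ {m : ℕ} where
  private
    V : Set
    V = Fin (suc m)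

  adj-sym : ∀ {x y : V} → Adj x y → Adj y x
  adj-sym {fzero}  {fsuc _} _        = tt
  adj-sym {fsuc _} {fzero}  _        = tt
  adj-sym {fsuc _} {fsuc _} (inj₁ e) = inj₂ e
  adj-sym {fsuc _} {fsuc _} (inj₂ e) = inj₁ e

  walk-snoc : ∀ {x y z : V} {d} → Walk x y d → Adj y z → Walk x z (suc d)
  walk-snoc here       a′ = step a′ here
  walk-snoc (step a w) a′ = step a (walk-snoc w a′)

  walk-reverse : ∀ {x y : V} {d} → Walk x y d → Walk y x d
  walk-reverse here       = here
  walk-reverse (step a w) = walk-snoc (walk-reverse w) (adj-sym a)

  dist-sym : ∀ {x y : V} {d} → Dist x y d → Dist y x d
  dist-sym (w , shortest) = walk-reverse w , λ d′ w′ → shortest d′ (walk-reverse w′)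

  dist-unique : ∀ {x y : V} {d e} → Dist x y d → Dist x y e → d ≡ e
  dist-unique (w , shortest) (w′ , shortest′) = ≤-antisym (shortest _ w′) (shortest′ _ w)

  dist-self : ∀ {x : V} → Dist x x 0
  dist-self = here , λ _ _ → z≤n

  dist-one : ∀ {x y : V} → x ≢ y → Adj x y → Dist x y 1
  dist-one {x} {y} x≢y a = step a here , shortest
    where
      shortest : ∀ d → Walk x y d → 1 ≤ d
      shortest zero    here = ⊥-elim (x≢y refl)
      shortest (suc d) _    = s≤s z≤n

  dist-two : ∀ {x y : V} → x ≢ y → ¬ Adj x y → Walk x y 2 → Dist x y 2
  dist-two {x} {y} x≢y ¬adj w = w , shortest
    where
      shortest : ∀ d → Walk x y d → 2 ≤ d
      shortest zero          here          = ⊥-elim (x≢y refl)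
      shortest (suc zero)    (step a here) = ⊥-elim (¬adj a)
      shortest (suc (suc d)) _             = s≤s (s≤s z≤n)

  hub-dist : ∀ {j : Fin m} → Dist hub (cyc j) 1
  hub-dist = dist-one (λ ()) tt

  dist-distinct : ∀ {x y : V} {d} → Dist x y (suc d) → x ≢ y
  dist-distinct (_ , shortest) refl with shortest 0 here
  ... | ()

  different-distance : ∀ {w x y : V} {a b} → Dist w x a → Dist w y b → a ≢ b → x ≢ y
  different-distance wx wy a≢b refl = a≢b (dist-unique wx wy)

  separates-by : ∀ {u v τ : V} {a b} → Dist u τ a → Dist v τ b → a ≢ b → Separates u v τ
  separates-by uτ vτ a≢b a′ b′ uτ′ vτ′ a′≡b′ =
    a≢b (trans (dist-unique uτ uτ′) (trans a′≡b′ (dist-unique vτ′ vτ)))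

  not-separated : ∀ {u v τ : V} {d} → Dist u τ d → Dist v τ d → ¬ Separates u v τ
  not-separated uτ vτ sep = sep _ _ uτ vτ refl

  separates-sym : ∀ {u v τ : V} → Separates u v τ → Separates v u τ
  separates-sym sep a b vτ uτ a≡b = sep b a uτ vτ (sym a≡b)

module Positions {n : ℕ} (2≤m : 2 ≤ suc n) where
  private
    m : ℕ
    m = suc n

  pos : Fin m → ℕ → Fin (suc m)
  pos b r = cyc (shift b r)

  pos-zero : ∀ b → pos b 0 ≡ cyc b
  pos-zero b = cong cyc (shift-zero b)

  reframe : ∀ b r s t → s + r ≡ t → pos (shift b r) s ≡ pos b t
  reframe b r s t s+r≡t =
    cong cyc (trans (shift-shift b r s) (cong (shift b) (trans (+-comm r s) s+r≡t)))

  reframe-wrap : ∀ b r s t → s + r ≡ t + m → pos (shift b r) s ≡ pos b t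
  reframe-wrap b r s t s+r≡t+m = cong cyc (shift-wrap b r s t (trans (+-comm r s) s+r≡t+m))

  pos-injective : ∀ b {r s} → r < m → s < m → pos b r ≡ pos b s → r ≡ s
  pos-injective b r<m s<m eq = shift-injective b r<m s<m (fsuc-injective eq)

  dist-next : ∀ b r → Dist (pos b r) (pos b (suc r)) 1
  dist-next b r = dist-one distinct (inj₁ next)
    where
      next : shift b (suc r) ≡ shift (shift b r) 1
      next = sym (trans (shift-shift b r 1) (cong (shift b) (+-comm r 1)))
      distinct : pos b r ≢ pos b (suc r)
      distinct eq with pos-injective (shift b r) (s≤s z≤n) 2≤m
                         (trans (pos-zero (shift b r)) (trans eq (cong cyc next)))
      ... | ()

  -- Positions whose offset d = 2 + e satisfies 2 ≤ d ≤ m ∸ 2 are at distance 2 (via the hub).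
  dist-far : ∀ b r e → 4 + e ≤ m → Dist (pos b r) (pos b (r + (2 + e))) 2
  dist-far b r e 4+e≤m =
    subst₂ (λ x y → Dist x y 2) (pos-zero c) (cong cyc (shift-shift b r _))
      (dist-two distinct non-adjacent (step {y = hub} tt (step tt here)))
    where
      c : Fin m
      c = shift b r
      d<m : 2 + e < m
      d<m = ≤-trans (n≤1+n (3 + e)) 4+e≤m
      d+1<m : (2 + e) + 1 < m
      d+1<m = subst (_< m) (+-comm 1 (2 + e)) 4+e≤m
      distinct : pos c 0 ≢ pos c (2 + e)
      distinct eq with pos-injective c (s≤s z≤n) d<m eq
      ... | ()
      non-adjacent : ¬ CycAdj (shift c 0) (shift c (2 + e))
      non-adjacent (inj₁ eq) with shift-injective c d<m 2≤m (trans eq (shift-shift c 0 1))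
      ... | ()
      non-adjacent (inj₂ eq)
        with shift-injective c (s≤s z≤n) d+1<m (trans eq (shift-shift c (2 + e) 1))
      ... | ()

module LargeWheel (k : ℕ) where
  m : ℕ
  m = 7 + k

  V : Set
  V = Fin (suc m)

  open Positions {6 + k} (s≤s (s≤s z≤n))

  ≤m : ∀ a → {{True (a ≤? 7)}} → a ≤ m
  ≤m a {{a≤?7}} = ≤-trans (toWitness a≤?7) (m≤m+n 7 k)

  +k≤m : ∀ a → {{True (a ≤? 7)}} → a + k ≤ m
  +k≤m a {{a≤?7}} = +-monoˡ-≤ k (toWitness a≤?7)

  module Landmarks (L : Subset (suc m)) where

    In : Fin m → ℕ → Set
    In b r = pos b r ∈ L

    in? : ∀ b r → Dec (In b r)
    in? b r = pos b r ∈? L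

    ∈-along : ∀ {x y} → x ≡ y → x ∈ L → y ∈ L
    ∈-along = subst (_∈ L)

    ∉-along : ∀ {x y} → x ≡ y → y ∉ L → x ∉ L
    ∉-along x≡y y∉L x∈L = y∉L (∈-along x≡y x∈L)

    landmark-period : ∀ b r → In b (r + m) → In b r
    landmark-period b r = ∈-along (cong cyc (shift-period b r))

    DoublySeparated : V → V → Set
    DoublySeparated u v =
      Σ (Fin 2 → V) λ f → Injective _≡_ _≡_ f × (∀ j → f j ∈ L × Separates u v (f j))

    two-separators : ∀ {u v x y} → x ≢ y → x ∈ L → y ∈ L →
                     Separates u v x → Separates u v y → DoublySeparated u v
    two-separators {u} {v} {x} {y} x≢y x∈L y∈L sx sy = f , injective , separating
      where
        f : Fin 2 → V
        f fzero    = x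
        f (fsuc _) = y
        injective : Injective _≡_ _≡_ f
        injective {fzero}      {fzero}      _ = refl
        injective {fzero}      {fsuc fzero} e = ⊥-elim (x≢y e)
        injective {fsuc fzero} {fzero}      e = ⊥-elim (x≢y (sym e))
        injective {fsuc fzero} {fsuc fzero} _ = refl
        separating : ∀ j → f j ∈ L × Separates u v (f j)
        separating fzero        = x∈L , sx
        separating (fsuc fzero) = y∈L , sy

    doubly-sym : ∀ {u v} → DoublySeparated u v → DoublySeparated v u
    doubly-sym (f , injective , separating) =
      f , injective , λ j → proj₁ (separating j) , separates-sym (proj₂ (separating j))

    -- The condition of the theorem (m ∸ 3, m ∸ 2, m ∸ 1 are 4 + k, 5 + k, 6 + k):
    -- two consecutive non-landmarks force the three positions on either side.
    GapCondition : Set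
    GapCondition =
      (i : Fin m) → cyc i ∉ L → cyc (shift i 1) ∉ L →
        cyc (shift i (4 + k)) ∈ L × cyc (shift i (5 + k)) ∈ L ×
        cyc (shift i (6 + k)) ∈ L × cyc (shift i 2) ∈ L ×
        cyc (shift i 3) ∈ L × cyc (shift i 4) ∈ L

    -- The gap condition read in the frame b at a gap r, r + 1 (positions before r
    -- are written r + (m ∸ j)).
    record Forced (b : Fin m) (r : ℕ) : Set where
      field
        minus₃ : In b (r + (4 + k))
        minus₂ : In b (r + (5 + k))
        minus₁ : In b (r + (6 + k))
        plus₂  : In b (2 + r)
        plus₃  : In b (3 + r)
        plus₄  : In b (4 + r)

    gap-forces : GapCondition → ∀ b r → ¬ In b r → ¬ In b (suc r) → Forced b r
    gap-forces gap b r r∉L r+1∉L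
      with gap (shift b r) r∉L (∉-along (reframe b r 1 (suc r) refl) r+1∉L)
    ... | m₃ , m₂ , m₁ , p₂ , p₃ , p₄ = record
      { minus₃ = ∈-along (reframe b r (4 + k) _ (+-comm (4 + k) r)) m₃
      ; minus₂ = ∈-along (reframe b r (5 + k) _ (+-comm (5 + k) r)) m₂
      ; minus₁ = ∈-along (reframe b r (6 + k) _ (+-comm (6 + k) r)) m₁
      ; plus₂  = ∈-along (reframe b r 2 (2 + r) refl) p₂
      ; plus₃  = ∈-along (reframe b r 3 (3 + r) refl) p₃
      ; plus₄  = ∈-along (reframe b r 4 (4 + r) refl) p₄
      }

    adjacent-separators : ∀ b τ → Separates (pos b 1) (pos b 2) τ →
                          (τ ≡ pos b 0 ⊎ τ ≡ pos b 3) ⊎ (τ ≡ pos b 1 ⊎ τ ≡ pos b 2)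
    adjacent-separators b fzero sep =
      ⊥-elim (not-separated (dist-sym hub-dist) (dist-sym hub-dist) sep)
    adjacent-separators b (fsuc j) sep with shift-onto b j
    ... | 0 , _ , refl = inj₁ (inj₁ refl)
    ... | 1 , _ , refl = inj₂ (inj₁ refl)
    ... | 2 , _ , refl = inj₂ (inj₂ refl)
    ... | 3 , _ , refl = inj₁ (inj₂ refl)
    ... | suc (suc (suc (suc e))) , 5+e≤m , refl =
      ⊥-elim (not-separated (dist-far b 1 (1 + e) 5+e≤m)
                            (dist-far b 2 e (≤-trans (n≤1+n (4 + e)) 5+e≤m)) sep)

    gap-separators : ∀ b τ → Separates (pos b 1) (pos b 3) τ →
                     (τ ≡ pos b 0 ⊎ τ ≡ pos b 1) ⊎ (τ ≡ pos b 3 ⊎ τ ≡ pos b 4)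
    gap-separators b fzero sep =
      ⊥-elim (not-separated (dist-sym hub-dist) (dist-sym hub-dist) sep)
    gap-separators b (fsuc j) sep with shift-onto b j
    ... | 0 , _ , refl = inj₁ (inj₁ refl)
    ... | 1 , _ , refl = inj₁ (inj₂ refl)
    ... | 2 , _ , refl = ⊥-elim (not-separated (dist-next b 1) (dist-sym (dist-next b 2)) sep)
    ... | 3 , _ , refl = inj₂ (inj₁ refl)
    ... | 4 , _ , refl = inj₂ (inj₂ refl)
    ... | suc (suc (suc (suc (suc e)))) , 6+e≤m , refl =
      ⊥-elim (not-separated (dist-far b 1 (2 + e) 6+e≤m)
                            (dist-far b 3 e (≤-trans (m≤n+m (4 + e) 2) 6+e≤m)) sep)

    forced-landmarks : ∀ {u v a a′ c c′} →
      (∀ τ → Separates u v τ → (τ ≡ a ⊎ τ ≡ a′) ⊎ (τ ≡ c ⊎ τ ≡ c′)) →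
      c ∉ L → c′ ∉ L → DoublySeparated u v → a ∈ L × a′ ∈ L
    forced-landmarks {a = a} {a′} classify c∉L c′∉L (f , injective , separating) =
      pick (among fzero) (among (fsuc fzero))
      where
        landmark : ∀ j → f j ∈ L
        landmark j = proj₁ (separating j)

        among : ∀ j → f j ≡ a ⊎ f j ≡ a′
        among j with classify (f j) (proj₂ (separating j))
        ... | inj₁ fj∈aa′       = fj∈aa′
        ... | inj₂ (inj₁ fj≡c)  = ⊥-elim (c∉L (∈-along fj≡c (landmark j)))
        ... | inj₂ (inj₂ fj≡c′) = ⊥-elim (c′∉L (∈-along fj≡c′ (landmark j)))

        distinct : f fzero ≢ f (fsuc fzero)
        distinct eq with injective eq
        ... | ()

        pick : f fzero ≡ a ⊎ f fzero ≡ a′ → f (fsuc fzero) ≡ a ⊎ f (fsuc fzero) ≡ a′ →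
               a ∈ L × a′ ∈ L
        pick (inj₁ f₀≡a)  (inj₂ f₁≡a′) =
          ∈-along f₀≡a (landmark fzero) , ∈-along f₁≡a′ (landmark (fsuc fzero))
        pick (inj₂ f₀≡a′) (inj₁ f₁≡a)  =
          ∈-along f₁≡a (landmark (fsuc fzero)) , ∈-along f₀≡a′ (landmark fzero)
        pick (inj₁ f₀≡a)  (inj₁ f₁≡a)  = ⊥-elim (distinct (trans f₀≡a (sym f₁≡a)))
        pick (inj₂ f₀≡a′) (inj₂ f₁≡a′) = ⊥-elim (distinct (trans f₀≡a′ (sym f₁≡a′)))

    -- In the frames β = i − 1 and γ = i − 3 the gap c_i, c_{i+1}
    -- sits at positions 1, 2 and 3, 4; the pairs (1, 2) of β, (1, 3) of i and (1, 3)
    -- of γ then force the six landmarks.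
    cond-of-landmark : IsAPLandmark 2 L → GapCondition
    cond-of-landmark isL i i∉L i+1∉L =
      ∈-along (pos-zero γ) (proj₁ left) ,
      ∈-along (reframe i (4 + k) 1 (5 + k) refl) (proj₂ left) ,
      ∈-along (pos-zero β) (proj₁ around) ,
      ∈-along (reframe-wrap i (6 + k) 3 2 refl) (proj₂ around) ,
      right
      where
        β γ : Fin m
        β = shift i (6 + k)
        γ = shift i (4 + k)

        i∉L′ : pos i 0 ∉ L
        i∉L′ = ∉-along (pos-zero i) i∉L

        around : pos β 0 ∈ L × pos β 3 ∈ L
        around = forced-landmarks (adjacent-separators β)
          (∉-along (reframe-wrap i (6 + k) 1 0 refl) i∉L′)
          (∉-along (reframe-wrap i (6 + k) 2 1 refl) i+1∉L)
          (isL (pos β 1) (pos β 2) (dist-distinct (dist-next β 1)))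

        right : pos i 3 ∈ L × pos i 4 ∈ L
        right = forced-landmarks (λ τ sep → swap (gap-separators i τ sep)) i∉L′ i+1∉L
          (isL (pos i 1) (pos i 3) (dist-distinct (dist-far i 1 0 (≤m 4))))

        left : pos γ 0 ∈ L × pos γ 1 ∈ L
        left = forced-landmarks (gap-separators γ)
          (∉-along (reframe-wrap i (4 + k) 3 0 refl) i∉L′)
          (∉-along (reframe-wrap i (4 + k) 4 1 refl) i+1∉L)
          (isL (pos γ 1) (pos γ 3) (dist-distinct (dist-far γ 1 0 (≤m 4))))

    record Near (u v x : V) : Set where
      constructor near
      field
        {d}   : ℕ
        close : Dist u x d
        d≤1   : d ≤ 1
        far   : Dist v x 2

    near-separates : ∀ {u v x} → Near u v x → Separates u v x
    near-separates (near ux d≤1 vx) = separates-by ux vx (<⇒≢ (s≤s d≤1))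

    near-separates′ : ∀ {u v x} → Near v u x → Separates u v x
    near-separates′ = separates-sym ∘ near-separates

    near-both : ∀ {u v x y} → Near u v x → x ∈ L → Near v u y → y ∈ L → DoublySeparated u v
    near-both nx@(near ux d≤1 _) x∈L ny@(near _ _ uy) y∈L =
      two-separators (different-distance ux uy (<⇒≢ (s≤s d≤1))) x∈L y∈L
        (near-separates nx) (near-separates′ ny)

    module Backward (gap : GapCondition) where
      open Forced

      forced : ∀ b r → ¬ In b r → ¬ In b (suc r) → Forced b r
      forced = gap-forces gap

      landmark-or-forced : ∀ {A : Set} b r →
        (In b r → A) → (In b (suc r) → A) → (Forced b r → A) → A
      landmark-or-forced b r at₀ at₁ gap-at with in? b r | in? b (suc r)
      ... | yes in₀ | _       = at₀ in₀
      ... | no _    | yes in₁ = at₁ in₁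
      ... | no ¬in₀ | no ¬in₁ = gap-at (forced b r ¬in₀ ¬in₁)

      one-in-three : ∀ {A : Set} b r →
        (In b r → A) → (In b (suc r) → A) → (In b (2 + r) → A) → A
      one-in-three b r at₀ at₁ at₂ = landmark-or-forced b r at₀ at₁ (at₂ ∘ plus₂)

      -- Four consecutive positions contain two landmarks; so if all four separate
      -- u and v, then u and v are doubly separated.
      window : ∀ b {u v} → Separates u v (pos b 0) → Separates u v (pos b 1) →
               Separates u v (pos b 2) → Separates u v (pos b 3) → DoublySeparated u v
      window b s₀ s₁ s₂ s₃ with in? b 1 | in? b 2
      ... | yes in₁ | yes in₂ = two-separators (dist-distinct (dist-next b 1)) in₁ in₂ s₁ s₂
      ... | no ¬in₁ | no ¬in₂ =
        two-separators (dist-distinct (dist-far b 0 1 (≤m 5)))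
          (landmark-period b 0 (minus₁ gap₁₂)) (plus₂ gap₁₂) s₀ s₃
        where gap₁₂ = forced b 1 ¬in₁ ¬in₂
      ... | yes in₁ | no ¬in₂ with in? b 3
      ...   | yes in₃ = two-separators (dist-distinct (dist-far b 1 0 (≤m 4))) in₁ in₃ s₁ s₃
      ...   | no ¬in₃ = two-separators (dist-distinct (dist-next b 0))
                          (landmark-period b 0 (minus₂ (forced b 2 ¬in₂ ¬in₃))) in₁ s₀ s₁
      window b s₀ s₁ s₂ s₃ | no ¬in₁ | yes in₂ with in? b 0
      ...   | yes in₀ = two-separators (dist-distinct (dist-far b 0 0 (≤m 4))) in₀ in₂ s₀ s₂
      ...   | no ¬in₀ = two-separators (dist-distinct (dist-next b 2))
                          in₂ (plus₃ (forced b 0 ¬in₀ ¬in₁)) s₂ s₃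

      -- Adjacent vertices c_1, c_2: each of c_0, …, c_3 separates them.
      adjacent-pair : ∀ b → DoublySeparated (pos b 1) (pos b 2)
      adjacent-pair b = window b
        (separates-by (dist-sym (dist-next b 0)) (dist-sym (dist-far b 0 0 (≤m 4))) (λ ()))
        (separates-by dist-self (dist-sym (dist-next b 1)) (λ ()))
        (separates-by (dist-next b 1) dist-self (λ ()))
        (separates-by (dist-far b 1 0 (≤m 4)) (dist-next b 2) (λ ()))

      -- c_1 and c_3: a landmark in {c_0, c_1} near c_1 and one in {c_3, c_4} near c_3,
      -- unless one of these pairs is a gap, which forces the other pair into L.
      gap-pair : ∀ b → DoublySeparated (pos b 1) (pos b 3)
      gap-pair b =
        landmark-or-forced b 0 (from-u near₀) (from-u near₁) λ gap₀₁ →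
          two-separators (dist-distinct (dist-next b 3)) (plus₃ gap₀₁) (plus₄ gap₀₁)
            (near-separates′ near₃) (near-separates′ near₄)
        where
          near₀ : Near (pos b 1) (pos b 3) (pos b 0)
          near₀ = near (dist-sym (dist-next b 0)) ≤-refl (dist-sym (dist-far b 0 1 (≤m 5)))
          near₁ : Near (pos b 1) (pos b 3) (pos b 1)
          near₁ = near dist-self z≤n (dist-sym (dist-far b 1 0 (≤m 4)))
          near₃ : Near (pos b 3) (pos b 1) (pos b 3)
          near₃ = near dist-self z≤n (dist-far b 1 0 (≤m 4))
          near₄ : Near (pos b 3) (pos b 1) (pos b 4)
          near₄ = near (dist-next b 3) ≤-refl (dist-far b 1 1 (≤m 5))

          from-u : ∀ {x} → Near (pos b 1) (pos b 3) x → x ∈ L →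
                   DoublySeparated (pos b 1) (pos b 3)
          from-u nx x∈L =
            landmark-or-forced b 3 (near-both nx x∈L near₃) (near-both nx x∈L near₄) λ gap₃₄ →
              two-separators (dist-distinct (dist-next b 0))
                (landmark-period b 0 (minus₃ gap₃₄)) (landmark-period b 1 (minus₂ gap₃₄))
                (near-separates near₀) (near-separates near₁)

      -- c_1 and c_{4+e} with 6 + e ≤ m: the triples around them are disjoint, and each
      -- contains a landmark near its own end.
      far-pair : ∀ b e → 6 + e ≤ m → DoublySeparated (pos b 1) (pos b (4 + e))
      far-pair b e 6+e≤m = one-in-three b 0 (from-u near₀) (from-u near₁) (from-u near₂)
        where
          5+e≤m : 5 + e ≤ m
          5+e≤m = ≤-trans (n≤1+n (5 + e)) 6+e≤m
          4+e≤m : 4 + e ≤ m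
          4+e≤m = ≤-trans (n≤1+n (4 + e)) 5+e≤m

          u v : V
          u = pos b 1
          v = pos b (4 + e)

          near₀ : Near u v (pos b 0)
          near₀ = near (dist-sym (dist-next b 0)) ≤-refl (dist-sym (dist-far b 0 (2 + e) 6+e≤m))
          near₁ : Near u v (pos b 1)
          near₁ = near dist-self z≤n (dist-sym (dist-far b 1 (1 + e) 5+e≤m))
          near₂ : Near u v (pos b 2)
          near₂ = near (dist-next b 1) ≤-refl (dist-sym (dist-far b 2 e 4+e≤m))
          near₃ : Near v u (pos b (3 + e))
          near₃ = near (dist-sym (dist-next b (3 + e))) ≤-refl (dist-far b 1 e 4+e≤m)
          near₄ : Near v u (pos b (4 + e))
          near₄ = near dist-self z≤n (dist-far b 1 (1 + e) 5+e≤m)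
          near₅ : Near v u (pos b (5 + e))
          near₅ = near (dist-next b (4 + e)) ≤-refl (dist-far b 1 (2 + e) 6+e≤m)

          from-u : ∀ {x} → Near u v x → x ∈ L → DoublySeparated u v
          from-u nx x∈L = one-in-three b (3 + e)
            (near-both nx x∈L near₃) (near-both nx x∈L near₄) (near-both nx x∈L near₅)

      -- The hub and c_{5+k}: each of c_0, …, c_3 is adjacent to the hub and at
      -- distance 2 from c_{5+k}.
      hub-pair : ∀ b → DoublySeparated hub (pos b (5 + k))
      hub-pair b = window b
        (separates-by hub-dist (dist-sym (dist-far b 0 (3 + k) ≤-refl)) (λ ()))
        (separates-by hub-dist (dist-sym (dist-far b 1 (2 + k) (+k≤m 6))) (λ ()))
        (separates-by hub-dist (dist-sym (dist-far b 2 (1 + k) (+k≤m 5))) (λ ()))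
        (separates-by hub-dist (dist-sym (dist-far b 3 k (+k≤m 4))) (λ ()))

      -- In the frame j + 2, the vertex c_j sits at position 5 + k.
      hub-cycle : ∀ j → DoublySeparated hub (cyc j)
      hub-cycle j = subst (DoublySeparated hub)
        (trans (reframe-wrap j 2 (5 + k) 0 (+-comm (5 + k) 2)) (pos-zero j))
        (hub-pair (shift j 2))

      -- In the frame a − 1, the vertices c_a and c_{a+r} sit at positions 1 and r + 1.
      in-frame-behind : ∀ a r →
        DoublySeparated (pos (shift a (6 + k)) 1) (pos (shift a (6 + k)) (suc r)) →
        DoublySeparated (cyc a) (pos a r)
      in-frame-behind a r = subst₂ DoublySeparated (trans (behind 0) (pos-zero a)) (behind r)
        where
          behind : ∀ s → pos (shift a (6 + k)) (suc s) ≡ pos a s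
          behind s = reframe-wrap a (6 + k) (suc s) s (sym (+-suc s (6 + k)))

      -- When s + t = m, the pair c_a, c_{a+t} is the pair c_{a+t}, c_{(a+t)+s} reversed.
      reversed : ∀ a t s → s + t ≡ 0 + m →
        DoublySeparated (pos a t) (pos (shift a t) s) → DoublySeparated (cyc a) (pos a t)
      reversed a t s s+t≡m = doubly-sym ∘
        subst (DoublySeparated (pos a t)) (trans (reframe-wrap a t s 0 s+t≡m) (pos-zero a))

      cycle-pair : ∀ a r → r < m → cyc a ≢ pos a r → DoublySeparated (cyc a) (pos a r)
      cycle-pair a 0 _ a≢a = ⊥-elim (a≢a (sym (pos-zero a)))
      cycle-pair a 1 _ _   = in-frame-behind a 1 (adjacent-pair (shift a (6 + k)))
      cycle-pair a 2 _ _   = in-frame-behind a 2 (gap-pair (shift a (6 + k)))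
      cycle-pair a (suc (suc (suc e))) r<m _ with e ≤? 1 + k
      ... | yes e≤1+k =
        in-frame-behind a (3 + e) (far-pair (shift a (6 + k)) e (+-monoʳ-≤ 6 e≤1+k))
      ... | no e≰1+k with last-two (≰⇒> e≰1+k) (s≤s⁻¹ (s≤s⁻¹ (s≤s⁻¹ (s≤s⁻¹ r<m))))
      ...   | inj₁ refl =
        reversed a (5 + k) 2 refl (in-frame-behind c 2 (gap-pair (shift c (6 + k))))
        where c = shift a (5 + k)
      ...   | inj₂ refl =
        reversed a (6 + k) 1 refl (in-frame-behind c 1 (adjacent-pair (shift c (6 + k))))
        where c = shift a (6 + k)

      landmark-of-cond : IsAPLandmark 2 L
      landmark-of-cond fzero    fzero    hub≢hub = ⊥-elim (hub≢hub refl)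
      landmark-of-cond fzero    (fsuc j) _       = hub-cycle j
      landmark-of-cond (fsuc j) fzero    _       = doubly-sym (hub-cycle j)
      landmark-of-cond (fsuc a) (fsuc c) a≢c with shift-onto a c
      ... | r , r<m , refl = cycle-pair a r r<m a≢c

  lower-bound : (L : Subset (suc m)) → Landmarks.GapCondition L → suc m / 2 ≤ ∣ L ∣
  lower-bound (h ∷ C) gap = begin
      suc m / 2          ≤⟨ half-bound (half-density m bit periodic gap-bits) ⟩
      ones m bit         ≡⟨ sum-cong m (λ z z<m → cong χ (bit-in-range z<m)) ⟩
      ones m (bitAt C)   ≡⟨ sym (size-as-sum C) ⟩
      ∣ C ∣              ≤⟨ ∣p∣≤∣x∷p∣ h C ⟩
      ∣ h ∷ C ∣          ∎
    where
      open ≤-Reasoning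
      open Landmarks (h ∷ C) using (In; Forced; gap-forces)
      open Forced

      bit : ℕ → Bool
      bit z = lookup C (shift fzero z)

      periodic : ∀ z → bit (z + m) ≡ bit z
      periodic z = cong (lookup C) (shift-period fzero z)

      bit-in-range : ∀ {z} → z < m → bit z ≡ bitAt C z
      bit-in-range {z} z<m = trans (sym (bitAt-toℕ C (shift fzero z)))
        (cong (bitAt C) (trans (shift-toℕ fzero z) (m<n⇒m%n≡m z<m)))

      landmark-bit : ∀ z → In fzero z → bit z ≡ true
      landmark-bit z (there z∈C) = []=⇒lookup z∈C

      non-landmark : ∀ z → bit z ≡ false → ¬ In fzero z
      non-landmark z bit≡false z∈L with trans (sym bit≡false) (landmark-bit z z∈L)
      ... | ()

      gap-bits : ∀ z → bit z ≡ false → bit (suc z) ≡ false → bit (2 + z) ∧ bit (3 + z) ≡ true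
      gap-bits z z∉L z+1∉L =
        cong₂ _∧_ (landmark-bit (2 + z) (plus₂ F)) (landmark-bit (3 + z) (plus₃ F))
        where F = gap-forces gap fzero z (non-landmark z z∉L) (non-landmark (suc z) z+1∉L)

  alternating : Subset (suc m)
  alternating = false ∷ evens m

  even-member : ∀ j → even (toℕ j) ≡ true → cyc j ∈ alternating
  even-member j even-j = there (lookup⇒[]= j (evens m) (trans (lookup-evens m j) even-j))

  -- It satisfies the gap condition vacuously: of two consecutive positions one is even
  -- (also across the wrap from m − 1 to 0).
  alternating-gap-free : Landmarks.GapCondition alternating
  alternating-gap-free i i∉ i+1∉ with even-or-next (toℕ i)
  ... | inj₁ even-i   = ⊥-elim (i∉ (even-member i even-i))
  ... | inj₂ even-i+1 = ⊥-elim (i+1∉ (even-member (shift i 1) (even-next (toℕ-shift-one i))))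
    where
      even-next : toℕ (shift i 1) ≡ suc (toℕ i) ⊎ toℕ (shift i 1) ≡ 0 →
                  even (toℕ (shift i 1)) ≡ true
      even-next (inj₁ next≡i+1) = trans (cong even next≡i+1) even-i+1
      even-next (inj₂ next≡0)   = cong even next≡0

-- A hub-free L is an AP-landmark set
-- for k = 2 iff it satisfies the gap condition;
-- the even positions form such a set of size ⌊n/2⌋, and every AP-landmark set has at
-- least ⌊n/2⌋ elements because it satisfies the gap condition.
mainTheorem8 : (m : ℕ) → 8 ≤ suc m →
    ((L : Subset (suc m)) → hub ∉ L →
      (IsAPLandmark 2 L ⇔
        ((i : Fin m) → cyc i ∉ L → cyc (shift i 1) ∉ L →
          cyc (shift i (m ∸ 3)) ∈ L × cyc (shift i (m ∸ 2)) ∈ L ×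
          cyc (shift i (m ∸ 1)) ∈ L × cyc (shift i 2) ∈ L ×
          cyc (shift i 3) ∈ L × cyc (shift i 4) ∈ L)))
    ×
    (Σ (Subset (suc m)) (λ L → IsAPLandmark 2 L × ∣ L ∣ ≡ suc m / 2)
      × ((L : Subset (suc m)) → IsAPLandmark 2 L → suc m / 2 ≤ ∣ L ∣))
mainTheorem8 _ (s≤s (s≤s (s≤s (s≤s (s≤s (s≤s (s≤s (s≤s (z≤n {k}))))))))) =
  (λ L _ → mk⇔ (Landmarks.cond-of-landmark L) (Landmarks.Backward.landmark-of-cond L)) ,
  (alternating ,
   Landmarks.Backward.landmark-of-cond alternating alternating-gap-free ,
   size-evens m) ,
  (λ L isL → lower-bound L (Landmarks.cond-of-landmark L isL))
  where open LargeWheel k
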